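{- Let $B=\{1234,4231\}$. For every positive integer $k$, the decreasing permutation $\pi=k(k-1)\cdots 21\in S_k$ is ES$^+$-irreducible with respect to $B$; that is, no entry $\pi(r)$, $r\in[k]$, is ES$^+$-reducible for $\pi$ with respect to $B$.
   Context: Permutations are written in one-line notation; $\operatorname{st}(w)$ of a sequence $w$ of distinct natural numbers is the unique permutation order isomorphic to $w$. A permutation contains $\beta$ if it has a subsequence order isomorphic to $\beta$, and avoids $\beta$ otherwise. For $\pi\in S_k$ and $\mathbf{g}=(g_1,\dots,g_{k+1})\in\mathbb{N}^{k+1}$ with $\|\mathbf{g}\|=g_1+\cdots+g_{k+1}$, let $Z(B;\pi;\mathbf{g})$ be the set of permutations $p$ of length $k+\|\mathbf{g}\|$ avoiding every element of $B$ such that $p(g_1+\cdots+g_i+i)=\pi(i)$ for $i=1,\dots,k$. For $r\in[k]$, $d_r(\pi)=\operatorname{st}(\pi \text{ with the entry }\pi(r)\text{ deleted})$ and $d_r(\mathbf{g})=(g_1,\dots,g_{r-1},g_r+g_{r+1},g_{r+2},\dots,g_{k+1})$. The entry $\pi(r)$ is ES$^+$-reducible for $\pi$ with respect to $B$ if $|Z(B;\pi;\mathbf{g})|=|Z(B;d_r(\pi);d_r(\mathbf{g}))|$ whenever $Z(B;\pi;\mathbf{g})\neq\emptyset$; $\pi$ is ES$^+$-irreducible if it has no ES$^+$-reducible entry. -}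

module Defs where

open import Data.Bool using (Bool; true; false; _∧_; _∨_; not; if_then_else_)
open import Data.Nat using (ℕ; zero; suc; _+_; _≤_; _<ᵇ_; _≡ᵇ_)
open import Data.List using (List; []; _∷_; map; length; filterᵇ; concatMap; take; downFrom; zipWith; upTo; _++_)
open import Data.Nat.ListAction using (sum)
open import Data.Bool.ListAction using (and; or)
open import Data.Vec using (Vec; toList)
open import Relation.Binary.PropositionalEquality using (_≡_)
open import Relation.Nullary using (¬_)

-- Permutations are lists of naturals in one-line notation, values 1..n.

insertions : ℕ → List ℕ → List (List ℕ)
insertions x [] = (x ∷ []) ∷ []
insertions x (y ∷ ys) = (x ∷ y ∷ ys) ∷ map (y ∷_) (insertions x ys)

perms : ℕ → List (List ℕ)
perms zero = [] ∷ []
perms (suc n) = concatMap (insertions (suc n)) (perms n)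

subseqs : List ℕ → List (List ℕ)
subseqs [] = [] ∷ []
subseqs (x ∷ xs) = map (x ∷_) (subseqs xs) ++ subseqs xs

st : List ℕ → List ℕ
st w = map (λ x → suc (length (filterᵇ (λ y → y <ᵇ x) w))) w

eqL : List ℕ → List ℕ → Bool
eqL [] [] = true
eqL (x ∷ xs) (y ∷ ys) = (x ≡ᵇ y) ∧ eqL xs ys
eqL _ _ = false

contains : List ℕ → List ℕ → Bool
contains p β = or (map (λ s → eqL (st s) β) (subseqs p))

avoidsAll : List (List ℕ) → List ℕ → Bool
avoidsAll B p = and (map (λ β → not (contains p β)) B)

-- 1-indexed lookup; returns 0 (never a permutation value) if out of range
at : List ℕ → ℕ → ℕ
at [] _ = 0
at (x ∷ xs) zero = 0
at (x ∷ xs) (suc zero) = x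
at (x ∷ xs) (suc (suc i)) = at xs (suc i)

positions : List ℕ → ℕ → List ℕ
positions g k = map (λ i → sum (take (suc i) g) + suc i) (upTo k)

-- p(g_1+...+g_i+i) = π(i) for i = 1..k
placed : List ℕ → List ℕ → List ℕ → Bool
placed π g p = and (zipWith (λ j v → at p j ≡ᵇ v) (positions g (length π)) π)

Zcount : List (List ℕ) → List ℕ → List ℕ → ℕ
Zcount B π g =
  length (filterᵇ (λ p → avoidsAll B p ∧ placed π g p) (perms (length π + sum g)))

deleteAt : ℕ → List ℕ → List ℕ
deleteAt _ [] = []
deleteAt zero xs = xs
deleteAt (suc zero) (x ∷ xs) = xs
deleteAt (suc (suc r)) (x ∷ xs) = x ∷ deleteAt (suc r) xs

dπ : ℕ → List ℕ → List ℕ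
dπ r π = st (deleteAt r π)

dg : ℕ → List ℕ → List ℕ
dg _ [] = []
dg zero xs = xs
dg (suc zero) (x ∷ []) = x ∷ []
dg (suc zero) (x ∷ y ∷ xs) = (x + y) ∷ xs
dg (suc (suc r)) (x ∷ xs) = x ∷ dg (suc r) xs

ESReducible : List (List ℕ) → (k : ℕ) → List ℕ → ℕ → Set
ESReducible B k π r =
  (g : Vec ℕ (suc k)) → ¬ (Zcount B π (toList g) ≡ 0) →
    Zcount B π (toList g) ≡ Zcount B (dπ r π) (dg r (toList g))

B₀ : List (List ℕ)
B₀ = (1 ∷ 2 ∷ 3 ∷ 4 ∷ []) ∷ (4 ∷ 2 ∷ 3 ∷ 1 ∷ []) ∷ []

decreasing : ℕ → List ℕ
decreasing k = map suc (downFrom k)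

-- Take gaps g with one free slot on each side of an entry e of π = k⋯1 (e = π(r) if r < k, and
-- e = π(k−1) = 2 if r = k ≥ 2).  A permutation in Z(B;π;g) puts the two new largest values into
-- these slots.  In every such filling, here and after the reduction, each ascent ends at one of
-- the two new values; so a 1234 would need three values above the old maximum, and a 4231 must
-- read (largest, b, second largest, d).  With the largest value first, e and the entry after the
-- second slot complete such a 4231, so |Z(B;π;g)| = 1.  Deleting π(r) merges the two slots into
-- a double slot in front of π(r+1), or, for r = k, leaves nothing after the second slot; then
-- both fillings avoid B and the reduced count is at least 2.  The case k = 1 is a finite
-- computation.
module Submission where

open import Defs
open import Data.Bool using (Bool; true; false; T; _∧_)
open import Data.Bool.ListAction using (and)
open import Data.Bool.Properties using (T-∧)
open import Data.Empty using (⊥; ⊥-elim)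
open import Data.List
  using (List; []; _∷_; _++_; length; map; filterᵇ; concatMap; take; drop; replicate; zipWith; applyUpTo)
open import Data.List.Properties
  using ( length-++; length-replicate; map-++; filter-++; filter-accept; filter-reject
        ; ++-assoc; ++-identityʳ; ++-cancelˡ; ∷-injective; ∷-injectiveˡ; ∷-injectiveʳ)
open import Data.List.Membership.Propositional using (_∈_; _∉_; find; lose)
open import Data.List.Membership.Propositional.Properties
  using (∈-++⁺ˡ; ∈-++⁺ʳ; ∈-++⁻; ∈-map⁺; ∈-map⁻; ∈-∃++; ∈-concat⁺′; ∈-concat⁻; ∈-filter⁺; ∈-filter⁻)
open import Data.List.Relation.Binary.Disjoint.Propositional using (Disjoint)
open import Data.List.Relation.Binary.Permutation.Propositional
  using (_↭_; ↭-refl; ↭-sym; ↭-trans; prep; swap)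
open import Data.List.Relation.Binary.Permutation.Propositional.Properties
  using ( ∈-resp-↭; All-resp-↭; shift; shifts; drop-mid; drop-∷; ↭-empty-inv; ↭-singleton-inv
        ; ↭-length; ++⁺ʳ)
open import Data.List.Relation.Binary.Sublist.Propositional
  using (_⊆_; []; _∷_; _∷ʳ_; ⊆-trans; to∈; from∈)
open import Data.List.Relation.Binary.Sublist.Propositional.Properties
  using (All-resp-⊆; ∷ˡ⁻; ∷⁻; ∷ʳ⁻; ++⁺ˡ)
open import Data.List.Relation.Unary.All as All using (All; []; _∷_)
open import Data.List.Relation.Unary.AllPairs using ([]; _∷_)
open import Data.List.Relation.Unary.Any using (here; there)
open import Data.List.Relation.Unary.Any.Properties using (any⁺; any⁻) renaming (map⁻ to Any-map⁻)
open import Data.List.Relation.Unary.Unique.Propositional using (Unique)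
open import Data.List.Relation.Unary.Unique.Propositional.Properties
  using (++⁺) renaming (map⁺ to Unique-map⁺; filter⁺ to Unique-filter⁺)
open import Data.Nat using (ℕ; zero; suc; _+_; _≤_; _<_; _<ᵇ_; _≡ᵇ_; z≤n; s≤s)
open import Data.Nat.ListAction using (sum)
open import Data.Nat.Properties
open import Data.Nat.Tactic.RingSolver using (solve-∀)
open import Data.Product using (_×_; _,_; proj₂; ∃-syntax)
open import Data.Sum using (_⊎_; inj₁; inj₂)
open import Data.Unit using (tt)
open import Data.Vec as Vec using (Vec; toList)
open import Function using (Equivalence; _∘_; id)
open import Relation.Binary.PropositionalEquality
open import Relation.Nullary using (¬_)
open import Relation.Nullary.Decidable using (T?)
open import Relation.Nullary.Reflects using (ofʸ; ofⁿ)

desc : ℕ → ℕ → List ℕ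
desc a zero    = []
desc a (suc n) = a + suc n ∷ desc a n

decreasing≡desc : ∀ k → decreasing k ≡ desc 0 k
decreasing≡desc zero    = refl
decreasing≡desc (suc k) = cong (suc k ∷_) (decreasing≡desc k)

desc-++ : ∀ a m n → desc a (m + n) ≡ desc (a + n) m ++ desc a n
desc-++ a zero    n = refl
desc-++ a (suc m) n = cong₂ _∷_ (top a m n) (desc-++ a m n)
  where
  top : ∀ a m n → a + suc (m + n) ≡ a + n + suc m
  top = solve-∀

length-desc : ∀ a n → length (desc a n) ≡ n
length-desc a zero    = refl
length-desc a (suc n) = cong suc (length-desc a n)

∈-desc⁻ : ∀ {x} a n → x ∈ desc a n → a < x × x ≤ a + n
∈-desc⁻ a (suc n) (here refl) = m<m+n a (s≤s z≤n) , ≤-refl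
∈-desc⁻ a (suc n) (there x∈) with ∈-desc⁻ a n x∈
... | a<x , x≤a+n = a<x , ≤-trans x≤a+n (+-monoʳ-≤ a (n≤1+n n))

top∈desc : ∀ a n → 0 < n → a + n ∈ desc a n
top∈desc a (suc n) _ = here refl

0∉desc : ∀ a n → 0 ∉ desc a n
0∉desc a n 0∈ with ∈-desc⁻ a n 0∈
... | () , _

desc-descending : ∀ {b c s} a n → b ∷ c ∷ s ⊆ desc a n → c < b
desc-descending a (suc n) (_ ∷ʳ bc⊆)  = desc-descending a n bc⊆
desc-descending a (suc n) (refl ∷ c⊆) = ≤-<-trans (proj₂ (∈-desc⁻ a n (to∈ c⊆))) (+-monoʳ-< a ≤-refl)

bounded-of-↭ : ∀ {p n} → p ↭ desc 0 n → All (_≤ n) p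
bounded-of-↭ {n = n} p↭ = All-resp-↭ (↭-sym p↭) (All.tabulate (proj₂ ∘ ∈-desc⁻ 0 n))

rank : ℕ → List ℕ → ℕ
rank x w = length (filterᵇ (_<ᵇ x) w)

rank-∷-< : ∀ {y} x w → y < x → rank x (y ∷ w) ≡ suc (rank x w)
rank-∷-< x w y<x = cong length (filter-accept (T? ∘ (_<ᵇ x)) (<⇒<ᵇ y<x))

rank-∷-≥ : ∀ {y} x w → x ≤ y → rank x (y ∷ w) ≡ rank x w
rank-∷-≥ {y} x w x≤y = cong length (filter-reject (T? ∘ (_<ᵇ x)) (λ y<ᵇx → <⇒≱ (<ᵇ⇒< y x y<ᵇx) x≤y))

rank-++ : ∀ x xs ys → rank x (xs ++ ys) ≡ rank x xs + rank x ys
rank-++ x xs ys = trans (cong length (filter-++ (T? ∘ (_<ᵇ x)) xs ys)) (length-++ (filterᵇ (_<ᵇ x) xs))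

rank-mono : ∀ {x y} → x ≤ y → ∀ w → rank x w ≤ rank y w
rank-mono x≤y [] = z≤n
rank-mono {x} {y} x≤y (z ∷ w)
  with z <ᵇ x | <ᵇ-reflects-< z x | z <ᵇ y | <ᵇ-reflects-< z y
... | true  | _       | true  | _       = s≤s (rank-mono x≤y w)
... | true  | ofʸ z<x | false | ofⁿ z≮y = ⊥-elim (z≮y (<-≤-trans z<x x≤y))
... | false | _       | true  | _       = m≤n⇒m≤1+n (rank-mono x≤y w)
... | false | _       | false | _       = rank-mono x≤y w

rank<⇒< : ∀ {x y} w → rank x w < rank y w → x < y
rank<⇒< w r< = ≰⇒> (λ y≤x → <⇒≱ r< (rank-mono y≤x w))

rank-desc-above : ∀ x a n → a + n < x → rank x (desc a n) ≡ n
rank-desc-above x a zero    _     = refl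
rank-desc-above x a (suc n) a+n<x = trans (rank-∷-< x (desc a n) a+n<x)
  (cong suc (rank-desc-above x a n (≤-<-trans (+-monoʳ-≤ a (n≤1+n n)) a+n<x)))

rank-desc-below : ∀ x a n → x ≤ a + 1 → rank x (desc a n) ≡ 0
rank-desc-below x a zero    _  = refl
rank-desc-below x a (suc n) x≤ =
  trans (rank-∷-≥ x (desc a n) (≤-trans x≤ (+-monoʳ-≤ a (s≤s z≤n)))) (rank-desc-below x a n x≤)

rank-desc-self : ∀ a n s → s < n → rank (a + suc s) (desc a n) ≡ s
rank-desc-self a (suc n) s (s≤s s≤n) with m≤n⇒m<n∨m≡n s≤n
... | inj₁ s<n  = trans (rank-∷-≥ (a + suc s) (desc a n) (+-monoʳ-≤ a (s≤s s≤n))) (rank-desc-self a n s s<n)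
... | inj₂ refl = trans (rank-∷-≥ (a + suc s) (desc a n) ≤-refl)
                        (rank-desc-above (a + suc s) a s (+-monoʳ-< a ≤-refl))

map-desc : ∀ (f : ℕ → ℕ) a a′ n → (∀ s → s < n → f (a + suc s) ≡ a′ + suc s) → map f (desc a n) ≡ desc a′ n
map-desc f a a′ zero    _  = refl
map-desc f a a′ (suc n) f≗ = cong₂ _∷_ (f≗ n ≤-refl) (map-desc f a a′ n (λ s s<n → f≗ s (m<n⇒m<1+n s<n)))

st-desc-++-desc : ∀ {a b} m n → a + m ≤ b → st (desc b n ++ desc a m) ≡ desc m n ++ desc 0 m
st-desc-++-desc {a} {b} m n gap = trans (map-++ f (desc b n) (desc a m)) (cong₂ _++_ upper lower)
  where
  w = desc b n ++ desc a m
  f : ℕ → ℕ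
  f x = suc (rank x w)
  upper : map f (desc b n) ≡ desc m n
  upper = map-desc f b m n λ s s<n → trans (cong suc (begin
    rank (b + suc s) w                                        ≡⟨ rank-++ (b + suc s) (desc b n) (desc a m) ⟩
    rank (b + suc s) (desc b n) + rank (b + suc s) (desc a m) ≡⟨ cong₂ _+_ (rank-desc-self b n s s<n)
                                                                   (rank-desc-above (b + suc s) a m
                                                                     (≤-<-trans gap (m<m+n b (s≤s z≤n)))) ⟩
    s + m                                                     ≡⟨ +-comm s m ⟩
    m + s                                                     ∎)) (sym (+-suc m s))
    where open ≡-Reasoning
  lower : map f (desc a m) ≡ desc 0 m
  lower = map-desc f a 0 m λ s s<m → cong suc (trans (rank-++ (a + suc s) (desc b n) (desc a m))
    (cong₂ _+_ (rank-desc-below (a + suc s) b n (≤-trans (+-monoʳ-≤ a s<m) (≤-trans gap (m≤m+n b 1))))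
               (rank-desc-self a m s s<m)))

module _ {a b c d : ℕ} where

  private
    s : List ℕ
    s = a ∷ b ∷ c ∷ d ∷ []

    st-ranks : ∀ {i j k l} → st s ≡ suc i ∷ suc j ∷ suc k ∷ suc l ∷ [] →
               rank a s ≡ i × rank b s ≡ j × rank c s ≡ k × rank d s ≡ l
    st-ranks refl = refl , refl , refl , refl

    ordered : ∀ {x y i j} → rank x s ≡ i → rank y s ≡ j → i < j → x < y
    ordered rx ry i<j = rank<⇒< s (subst₂ _<_ (sym rx) (sym ry) i<j)

  st≡1234⇒ : st s ≡ 1 ∷ 2 ∷ 3 ∷ 4 ∷ [] → a < b × b < c × c < d
  st≡1234⇒ eq with st-ranks eq
  ... | ra , rb , rc , rd = ordered ra rb ≤-refl , ordered rb rc ≤-refl , ordered rc rd ≤-refl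

  st≡4231⇒ : st s ≡ 4 ∷ 2 ∷ 3 ∷ 1 ∷ [] → d < b × b < c × c < a
  st≡4231⇒ eq with st-ranks eq
  ... | ra , rb , rc , rd = ordered rd rb (s≤s z≤n) , ordered rb rc ≤-refl , ordered rc ra ≤-refl

  st≡4231⇐ : d < b → b < c → c < a → st s ≡ 4 ∷ 2 ∷ 3 ∷ 1 ∷ []
  st≡4231⇐ d<b b<c c<a =
    cong₂ _∷_ (cong suc ra) (cong₂ _∷_ (cong suc rb) (cong₂ _∷_ (cong suc rc) (cong₂ _∷_ (cong suc rd) refl)))
    where
    b<a = <-trans b<c c<a
    d<c = <-trans d<b b<c
    d<a = <-trans d<c c<a
    ra : rank a s ≡ 3
    ra = trans (rank-∷-≥ a _ ≤-refl) (trans (rank-∷-< a _ b<a)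
           (cong suc (trans (rank-∷-< a _ c<a) (cong suc (rank-∷-< a [] d<a)))))
    rb : rank b s ≡ 1
    rb = trans (rank-∷-≥ b _ (<⇒≤ b<a)) (trans (rank-∷-≥ b _ ≤-refl)
           (trans (rank-∷-≥ b _ (<⇒≤ b<c)) (rank-∷-< b [] d<b)))
    rc : rank c s ≡ 2
    rc = trans (rank-∷-≥ c _ (<⇒≤ c<a)) (trans (rank-∷-< c _ b<c)
           (cong suc (trans (rank-∷-≥ c _ ≤-refl) (rank-∷-< c [] d<c))))
    rd : rank d s ≡ 0
    rd = trans (rank-∷-≥ d _ (<⇒≤ d<a)) (trans (rank-∷-≥ d _ (<⇒≤ d<b))
           (trans (rank-∷-≥ d _ (<⇒≤ d<c)) (rank-∷-≥ d [] ≤-refl)))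

∈-subseqs⁺ : ∀ {s p} → s ⊆ p → s ∈ subseqs p
∈-subseqs⁺ []                     = here refl
∈-subseqs⁺ (_∷ʳ_ {ys = ys} y s⊆p) = ∈-++⁺ʳ (map (y ∷_) (subseqs ys)) (∈-subseqs⁺ s⊆p)
∈-subseqs⁺ (refl ∷ s⊆p)           = ∈-++⁺ˡ (∈-map⁺ (_ ∷_) (∈-subseqs⁺ s⊆p))

∈-subseqs⁻ : ∀ {s} p → s ∈ subseqs p → s ⊆ p
∈-subseqs⁻ []       (here refl) = []
∈-subseqs⁻ (y ∷ ys) s∈ with ∈-++⁻ (map (y ∷_) (subseqs ys)) s∈
... | inj₂ s∈ys = y ∷ʳ ∈-subseqs⁻ ys s∈ys
... | inj₁ s∈y∷ys with ∈-map⁻ (y ∷_) s∈y∷ys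
...   | s′ , s′∈ys , refl = refl ∷ ∈-subseqs⁻ ys s′∈ys

eqL⇒≡ : ∀ xs ys → T (eqL xs ys) → xs ≡ ys
eqL⇒≡ []       []       _ = refl
eqL⇒≡ (x ∷ xs) (y ∷ ys) e with Equivalence.to T-∧ e
... | x≡ᵇy , rest = cong₂ _∷_ (≡ᵇ⇒≡ x y x≡ᵇy) (eqL⇒≡ xs ys rest)

eqL-refl : ∀ xs → T (eqL xs xs)
eqL-refl []       = tt
eqL-refl (x ∷ xs) = Equivalence.from T-∧ (≡⇒≡ᵇ x x refl , eqL-refl xs)

contains⁻ : ∀ p β → T (contains p β) → ∃[ s ] s ⊆ p × st s ≡ β
contains⁻ p β c with find (any⁻ (λ s → eqL (st s) β) (subseqs p) c)
... | s , s∈ , e = s , ∈-subseqs⁻ p s∈ , eqL⇒≡ (st s) β e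

contains⁺ : ∀ {s p β} → s ⊆ p → st s ≡ β → T (contains p β)
contains⁺ {s} {p} {β} s⊆p refl = any⁺ (λ s → eqL (st s) β) (lose (∈-subseqs⁺ s⊆p) (eqL-refl (st s)))

four-entries : ∀ {s : List ℕ} {β} → st s ≡ β → length β ≡ 4 → ∃[ a ] ∃[ b ] ∃[ c ] ∃[ d ] s ≡ a ∷ b ∷ c ∷ d ∷ []
four-entries {a ∷ b ∷ c ∷ d ∷ []}          _    _  = a , b , c , d , refl
four-entries {[]}                          refl ()
four-entries {_ ∷ []}                      refl ()
four-entries {_ ∷ _ ∷ []}                  refl ()
four-entries {_ ∷ _ ∷ _ ∷ []}              refl ()
four-entries {_ ∷ _ ∷ _ ∷ _ ∷ _ ∷ _}       refl ()

avoidsAll-B₀⁺ : ∀ p → ¬ T (contains p (1 ∷ 2 ∷ 3 ∷ 4 ∷ [])) → ¬ T (contains p (4 ∷ 2 ∷ 3 ∷ 1 ∷ [])) →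
                T (avoidsAll B₀ p)
avoidsAll-B₀⁺ p no1234 no4231 with contains p (1 ∷ 2 ∷ 3 ∷ 4 ∷ []) | contains p (4 ∷ 2 ∷ 3 ∷ 1 ∷ [])
... | false | false = tt
... | true  | _     = ⊥-elim (no1234 tt)
... | false | true  = ⊥-elim (no4231 tt)

avoidsAll-B₀⁻ : ∀ p → T (avoidsAll B₀ p) → ¬ T (contains p (4 ∷ 2 ∷ 3 ∷ 1 ∷ []))
avoidsAll-B₀⁻ p avoids with contains p (1 ∷ 2 ∷ 3 ∷ 4 ∷ []) | contains p (4 ∷ 2 ∷ 3 ∷ 1 ∷ [])
... | false | false = λ ()
... | true  | _     = ⊥-elim avoids
... | false | true  = ⊥-elim avoids

Avoids1234 : List ℕ → Set
Avoids1234 p = ∀ {a b c d} → a ∷ b ∷ c ∷ d ∷ [] ⊆ p → a < b → b < c → c < d → ⊥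

Avoids4231 : List ℕ → Set
Avoids4231 p = ∀ {a b c d} → a ∷ b ∷ c ∷ d ∷ [] ⊆ p → d < b → b < c → c < a → ⊥

avoids⇒avoidsAll-B₀ : ∀ {p} → Avoids1234 p → Avoids4231 p → T (avoidsAll B₀ p)
avoids⇒avoidsAll-B₀ {p} avoid1234 avoid4231 = avoidsAll-B₀⁺ p no1234 no4231
  where
  no1234 : ¬ T (contains p (1 ∷ 2 ∷ 3 ∷ 4 ∷ []))
  no1234 c with contains⁻ p _ c
  ... | s , s⊆p , e with four-entries e refl
  ...   | a , b , c , d , refl with st≡1234⇒ e
  ...     | a<b , b<c , c<d = avoid1234 s⊆p a<b b<c c<d
  no4231 : ¬ T (contains p (4 ∷ 2 ∷ 3 ∷ 1 ∷ []))
  no4231 c with contains⁻ p _ c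
  ... | s , s⊆p , e with four-entries e refl
  ...   | a , b , c , d , refl with st≡4231⇒ e
  ...     | d<b , b<c , c<a = avoid4231 s⊆p d<b b<c c<a

occurrence4231⇒¬avoidsAll-B₀ : ∀ {p a b c d} → a ∷ b ∷ c ∷ d ∷ [] ⊆ p → d < b → b < c → c < a →
                               ¬ T (avoidsAll B₀ p)
occurrence4231⇒¬avoidsAll-B₀ {p} occ d<b b<c c<a avoids =
  avoidsAll-B₀⁻ p avoids (contains⁺ occ (st≡4231⇐ d<b b<c c<a))

AscentsAbove : ℕ → List ℕ → Set
AscentsAbove t w = ∀ {b c} → b ∷ c ∷ [] ⊆ w → b < c → t < c

ascentsAbove-desc : ∀ t a n → AscentsAbove t (desc a n)
ascentsAbove-desc t a n bc⊆ b<c = ⊥-elim (<-asym b<c (desc-descending a n bc⊆))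

ascentsAbove-insert : ∀ {t x} xs {ys} → t < x → AscentsAbove t (xs ++ ys) → AscentsAbove t (xs ++ x ∷ ys)
ascentsAbove-insert []       t<x asc (refl ∷ _)  b<c = <-trans t<x b<c
ascentsAbove-insert []       t<x asc (_ ∷ʳ bc⊆)  b<c = asc bc⊆ b<c
ascentsAbove-insert (z ∷ xs) t<x asc (_ ∷ʳ bc⊆)  b<c = ascentsAbove-insert xs t<x (λ p → asc (z ∷ʳ p)) bc⊆ b<c
ascentsAbove-insert (z ∷ xs) t<x asc (refl ∷ c⊆) b<c with ∈-++⁻ xs (to∈ c⊆)
... | inj₁ c∈xs         = asc (refl ∷ from∈ (∈-++⁺ˡ c∈xs)) b<c
... | inj₂ (here refl)  = t<x
... | inj₂ (there c∈ys) = asc (refl ∷ from∈ (∈-++⁺ʳ xs c∈ys)) b<c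

module _ {t : ℕ} {w : List ℕ} (asc : AscentsAbove t w) (bounded : All (_≤ suc (suc t)) w) where

  avoids1234 : Avoids1234 w
  avoids1234 occ a<b b<c c<d with All-resp-⊆ occ bounded
  ... | _ ∷ _ ∷ _ ∷ d≤ ∷ [] =
    <⇒≱ (≤-<-trans (≤-trans (s≤s (asc (⊆-trans (refl ∷ refl ∷ _ ∷ʳ _ ∷ʳ []) occ) a<b)) b<c) c<d) d≤

  -- The ascent b < c puts c above t, and c < a ≤ t + 2 then pins c = t + 1 and a = t + 2.
  avoids4231 : (∀ {b d} → ¬ (suc (suc t) ∷ b ∷ suc t ∷ d ∷ [] ⊆ w)) → Avoids4231 w
  avoids4231 noSplit occ d<b b<c c<a with All-resp-⊆ occ bounded
  ... | a≤ ∷ _ = split occ c≡ (≤-antisym a≤ (subst (λ c → suc c ≤ _) c≡ c<a))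
    where
    t<c = asc (∷ˡ⁻ (⊆-trans (refl ∷ refl ∷ refl ∷ _ ∷ʳ []) occ)) b<c
    c≡ = ≤-antisym (≤-pred (<-≤-trans c<a a≤)) t<c
    split : ∀ {a b c d} → a ∷ b ∷ c ∷ d ∷ [] ⊆ w → c ≡ suc t → a ≡ suc (suc t) → ⊥
    split occ′ refl refl = noSplit occ′

  ascentsAbove⇒avoidsAll-B₀ : (∀ {b d} → ¬ (suc (suc t) ∷ b ∷ suc t ∷ d ∷ [] ⊆ w)) → T (avoidsAll B₀ w)
  ascentsAbove⇒avoidsAll-B₀ noSplit = avoids⇒avoidsAll-B₀ avoids1234 (avoids4231 noSplit)

∷⊆-++⁻ : ∀ {x : ℕ} {s} xs {ys} → x ∉ xs → x ∷ s ⊆ xs ++ ys → x ∷ s ⊆ ys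
∷⊆-++⁻ []       _  occ        = occ
∷⊆-++⁻ (z ∷ xs) x∉ (_ ∷ʳ occ) = ∷⊆-++⁻ xs (x∉ ∘ there) occ
∷⊆-++⁻ (z ∷ xs) x∉ (refl ∷ _) = ⊥-elim (x∉ (here refl))

∈-concatMap⁻ : ∀ {A B : Set} (f : A → List B) {v} xs → v ∈ concatMap f xs → ∃[ x ] x ∈ xs × v ∈ f x
∈-concatMap⁻ f xs v∈ = find (Any-map⁻ (∈-concat⁻ (map f xs) v∈))

∈-concatMap⁺ : ∀ {A B : Set} (f : A → List B) {v x xs} → x ∈ xs → v ∈ f x → v ∈ concatMap f xs
∈-concatMap⁺ f x∈ v∈ = ∈-concat⁺′ v∈ (∈-map⁺ f x∈)

concatMap-unique : ∀ {A B : Set} (f : A → List B) {xs} → Unique xs →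
                   (∀ {x} → x ∈ xs → Unique (f x)) →
                   (∀ {x y} → x ∈ xs → y ∈ xs → x ≢ y → Disjoint (f x) (f y)) →
                   Unique (concatMap f xs)
concatMap-unique f []                _      _        = []
concatMap-unique f {x ∷ xs} (x∉xs ∷ uxs) unique disjoint =
  ++⁺ (unique (here refl)) (concatMap-unique f uxs (unique ∘ there) (λ y∈ z∈ → disjoint (there y∈) (there z∈)))
      disjoint-rest
  where
  disjoint-rest : Disjoint (f x) (concatMap f xs)
  disjoint-rest (v∈fx , v∈rest) with ∈-concatMap⁻ f xs v∈rest
  ... | y , y∈xs , v∈fy = disjoint (here refl) (there y∈xs) (All.lookup x∉xs y∈xs) (v∈fx , v∈fy)

∈-insertions⁻ : ∀ {x p} q → p ∈ insertions x q → ∃[ as ] ∃[ bs ] q ≡ as ++ bs × p ≡ as ++ x ∷ bs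
∈-insertions⁻ []       (here refl) = [] , [] , refl , refl
∈-insertions⁻ (y ∷ ys) (here refl) = [] , y ∷ ys , refl , refl
∈-insertions⁻ (y ∷ ys) (there p∈) with ∈-map⁻ (y ∷_) p∈
... | _ , p′∈ , refl with ∈-insertions⁻ ys p′∈
...   | as , bs , refl , refl = y ∷ as , bs , refl , refl

∈-insertions⁺ : ∀ x as bs → as ++ x ∷ bs ∈ insertions x (as ++ bs)
∈-insertions⁺ x []       []       = here refl
∈-insertions⁺ x []       (b ∷ bs) = here refl
∈-insertions⁺ x (a ∷ as) bs       = there (∈-map⁺ (a ∷_) (∈-insertions⁺ x as bs))

++-∷-cancel-fresh : ∀ {x : ℕ} as bs as′ bs′ → x ∉ as → x ∉ as′ →
                    as ++ x ∷ bs ≡ as′ ++ x ∷ bs′ → as ≡ as′ × bs ≡ bs′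
++-∷-cancel-fresh []       bs []         bs′ _    _     eq = refl , ∷-injectiveʳ eq
++-∷-cancel-fresh []       bs (a′ ∷ as′) bs′ _    x∉as′ eq = ⊥-elim (x∉as′ (here (∷-injectiveˡ eq)))
++-∷-cancel-fresh (a ∷ as) bs []         bs′ x∉as _     eq = ⊥-elim (x∉as (here (sym (∷-injectiveˡ eq))))
++-∷-cancel-fresh (a ∷ as) bs (a′ ∷ as′) bs′ x∉as x∉as′ eq with ∷-injective eq
... | refl , eq′ with ++-∷-cancel-fresh as bs as′ bs′ (x∉as ∘ there) (x∉as′ ∘ there) eq′
...   | refl , refl = refl , refl

insertions-unique : ∀ {x} q → x ∉ q → Unique (insertions x q)
insertions-unique []           _  = [] ∷ []
insertions-unique {x} (y ∷ ys) x∉ =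
  All.tabulate new-head ∷ Unique-map⁺ ∷-injectiveʳ (insertions-unique ys (x∉ ∘ there))
  where
  new-head : ∀ {p} → p ∈ map (y ∷_) (insertions x ys) → x ∷ y ∷ ys ≢ p
  new-head p∈ eq with ∈-map⁻ (y ∷_) p∈
  ... | _ , _ , refl = x∉ (here (∷-injectiveˡ eq))

insertions-disjoint : ∀ {x q q′} → x ∉ q → x ∉ q′ → q ≢ q′ → Disjoint (insertions x q) (insertions x q′)
insertions-disjoint {x} {q} {q′} x∉q x∉q′ q≢q′ (p∈ , p∈′)
  with ∈-insertions⁻ q p∈ | ∈-insertions⁻ q′ p∈′
... | as , bs , refl , refl | as′ , bs′ , refl , eq
  with ++-∷-cancel-fresh as bs as′ bs′ (x∉q ∘ ∈-++⁺ˡ) (x∉q′ ∘ ∈-++⁺ˡ) eq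
...   | refl , refl = q≢q′ refl

∈-perms⁻ : ∀ n {p} → p ∈ perms n → p ↭ desc 0 n
∈-perms⁻ zero    (here refl) = ↭-refl
∈-perms⁻ (suc n) p∈ with ∈-concatMap⁻ (insertions (suc n)) (perms n) p∈
... | q , q∈ , p∈ins with ∈-insertions⁻ q p∈ins
...   | as , bs , refl , refl = ↭-trans (shift (suc n) as bs) (prep (suc n) (∈-perms⁻ n q∈))

∈-perms⁺ : ∀ n {p} → p ↭ desc 0 n → p ∈ perms n
∈-perms⁺ zero    p↭ rewrite ↭-empty-inv p↭ = here refl
∈-perms⁺ (suc n) p↭ with ∈-∃++ (∈-resp-↭ (↭-sym p↭) (here refl))
... | as , bs , refl =
  ∈-concatMap⁺ (insertions (suc n)) (∈-perms⁺ n (drop-mid as [] p↭)) (∈-insertions⁺ (suc n) as bs)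

perms-unique : ∀ n → Unique (perms n)
perms-unique zero    = [] ∷ []
perms-unique (suc n) =
  concatMap-unique (insertions (suc n)) (perms-unique n)
    (λ q∈ → insertions-unique _ (fresh q∈)) (λ q∈ q′∈ → insertions-disjoint (fresh q∈) (fresh q′∈))
  where
  fresh : ∀ {q} → q ∈ perms n → suc n ∉ q
  fresh q∈ sn∈ = <-irrefl refl (proj₂ (∈-desc⁻ 0 n (∈-resp-↭ (∈-perms⁻ n q∈) sn∈)))

↭-pull₂ : ∀ {A : Set} (xs ys zs : List A) a b → xs ++ a ∷ ys ++ b ∷ zs ↭ a ∷ b ∷ xs ++ ys ++ zs
↭-pull₂ xs ys zs a b =
  ↭-trans (shift a xs (ys ++ b ∷ zs))
    (prep a (subst₂ _↭_ (++-assoc xs ys (b ∷ zs)) (cong (b ∷_) (++-assoc xs ys zs)) (shift b (xs ++ ys) zs)))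

↭-cancelˡ : ∀ {A : Set} (xs : List A) {ys zs} → xs ++ ys ↭ xs ++ zs → ys ↭ zs
↭-cancelˡ []       ys↭zs = ys↭zs
↭-cancelˡ (x ∷ xs) ys↭zs = ↭-cancelˡ xs (drop-∷ ys↭zs)

↭-pair⁻ : ∀ {A : Set} {x y a b : A} {q} → x ∷ y ∷ q ↭ a ∷ b ∷ [] →
          q ≡ [] × ((x ≡ a × y ≡ b) ⊎ (x ≡ b × y ≡ a))
↭-pair⁻ {q = []} xy↭ with ∈-resp-↭ xy↭ (here refl)
... | here refl         = refl , inj₁ (refl , ∷-injectiveˡ (↭-singleton-inv (drop-∷ xy↭)))
... | there (here refl) =
  refl , inj₂ (refl , ∷-injectiveˡ (↭-singleton-inv (drop-∷ (↭-trans xy↭ (swap _ _ ↭-refl)))))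
↭-pair⁻ {q = _ ∷ _} xy↭ with ↭-length xy↭
... | ()

module _ {A : Set} where

  length-unique-const : ∀ {w : A} {ys} → Unique ys → (∀ {y} → y ∈ ys → y ≡ w) → length ys ≤ 1
  length-unique-const []           _     = z≤n
  length-unique-const (_ ∷ [])     _     = s≤s z≤n
  length-unique-const (y∉ ∷ _ ∷ _) all≡w =
    ⊥-elim (All.lookup y∉ (here refl) (trans (all≡w (here refl)) (sym (all≡w (there (here refl))))))

  length-∈ : ∀ {x : A} {ys} → x ∈ ys → 1 ≤ length ys
  length-∈ (here _)  = s≤s z≤n
  length-∈ (there _) = s≤s z≤n

  length-∈₂ : ∀ {x y : A} {ys} → x ∈ ys → y ∈ ys → x ≢ y → 2 ≤ length ys
  length-∈₂ (here refl) (here refl) x≢y = ⊥-elim (x≢y refl)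
  length-∈₂ (here _)    (there y∈)  _   = s≤s (length-∈ y∈)
  length-∈₂ (there x∈)  (here _)    _   = s≤s (length-∈ x∈)
  length-∈₂ (there x∈)  (there y∈)  x≢y = s≤s (≤-trans (s≤s z≤n) (length-∈₂ x∈ y∈ x≢y))

  count-unique : ∀ (P : A → Bool) {xs w} → Unique xs → (∀ {x} → x ∈ xs → T (P x) → x ≡ w) →
                 length (filterᵇ P xs) ≤ 1
  count-unique P {xs} uxs only = length-unique-const (Unique-filter⁺ (T? ∘ P) uxs)
    (λ y∈ → let y∈xs , Py = ∈-filter⁻ (T? ∘ P) {xs = xs} y∈ in only y∈xs Py)

  count-∈ : ∀ (P : A → Bool) {xs w} → w ∈ xs → T (P w) → 1 ≤ length (filterᵇ P xs)
  count-∈ P w∈ Pw = length-∈ (∈-filter⁺ (T? ∘ P) w∈ Pw)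

  count-∈₂ : ∀ (P : A → Bool) {xs w w′} → w ∈ xs → w′ ∈ xs → w ≢ w′ → T (P w) → T (P w′) →
             2 ≤ length (filterᵇ P xs)
  count-∈₂ P w∈ w′∈ w≢w′ Pw Pw′ = length-∈₂ (∈-filter⁺ (T? ∘ P) w∈ Pw) (∈-filter⁺ (T? ∘ P) w′∈ Pw′) w≢w′

map-applyUpTo : ∀ (f g : ℕ → ℕ) n → map f (applyUpTo g n) ≡ applyUpTo (f ∘ g) n
map-applyUpTo f g zero    = refl
map-applyUpTo f g (suc n) = cong (f (g 0) ∷_) (map-applyUpTo f (g ∘ suc) n)

slot : List ℕ → ℕ → ℕ
slot gs i = sum (take (suc i) gs) + suc i

matches : List ℕ → (ℕ → ℕ) → List ℕ → Bool
matches p f π = and (zipWith (λ j v → at p j ≡ᵇ v) (applyUpTo f (length π)) π)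

placed≡matches : ∀ π gs p → placed π gs p ≡ matches p (slot gs) π
placed≡matches π gs p =
  cong (λ js → and (zipWith (λ j v → at p j ≡ᵇ v) js π)) (map-applyUpTo (slot gs) id (length π))

matches-cong : ∀ p q {f g} π → (∀ i → at p (f i) ≡ at q (g i)) → matches p f π ≡ matches q g π
matches-cong p q []      _   = refl
matches-cong p q (x ∷ π) f≗g = cong₂ (λ a b → (a ≡ᵇ x) ∧ b) (f≗g 0) (matches-cong p q π (f≗g ∘ suc))

at-drop : ∀ n p j → at p (n + suc j) ≡ at (drop n p) (suc j)
at-drop zero    p        j = refl
at-drop (suc n) []       j = refl
at-drop (suc n) (y ∷ ys) j =
  trans (cong (λ k → at (y ∷ ys) (suc k)) (+-suc n j)) (trans (cong (at ys) (sym (+-suc n j))) (at-drop n ys j))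

slot-∷-suc : ∀ g gs i → slot (g ∷ gs) (suc i) ≡ suc g + slot gs i
slot-∷-suc g gs i = arith g (sum (take (suc i) gs)) i
  where
  arith : ∀ g s i → g + s + suc (suc i) ≡ suc g + (s + suc i)
  arith = solve-∀

placed-∷ : ∀ x π g gs p → placed (x ∷ π) (g ∷ gs) p ≡ (at p (suc g) ≡ᵇ x) ∧ placed π gs (drop (suc g) p)
placed-∷ x π g gs p = begin
  placed (x ∷ π) (g ∷ gs) p                                         ≡⟨ placed≡matches (x ∷ π) (g ∷ gs) p ⟩
  (at p (slot (g ∷ gs) 0) ≡ᵇ x) ∧ matches p (slot (g ∷ gs) ∘ suc) π ≡⟨ cong₂ (λ j b → (at p j ≡ᵇ x) ∧ b) first rest ⟩
  (at p (suc g) ≡ᵇ x) ∧ matches (drop (suc g) p) (slot gs) π        ≡⟨ cong ((at p (suc g) ≡ᵇ x) ∧_)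
                                                                         (sym (placed≡matches π gs (drop (suc g) p))) ⟩
  (at p (suc g) ≡ᵇ x) ∧ placed π gs (drop (suc g) p)                ∎
  where
  open ≡-Reasoning
  first : slot (g ∷ gs) 0 ≡ suc g
  first = trans (+-comm (g + 0) 1) (cong suc (+-identityʳ g))
  rest : matches p (slot (g ∷ gs) ∘ suc) π ≡ matches (drop (suc g) p) (slot gs) π
  rest = matches-cong p (drop (suc g) p) π λ i →
    trans (cong (at p) (trans (slot-∷-suc g gs i) (cong (suc g +_) (+-suc _ i))))
          (trans (at-drop (suc g) p _) (cong (at (drop (suc g) p)) (sym (+-suc _ i))))

-- `at` answers 0 outside the list, so a nonzero answer certifies that position suc g exists.
at-split : ∀ g p → at p (suc g) ≢ 0 → ∃[ as ] length as ≡ g × p ≡ as ++ at p (suc g) ∷ drop (suc g) p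
at-split g       []       nz = ⊥-elim (nz refl)
at-split zero    (y ∷ ys) _  = [] , refl , refl
at-split (suc g) (y ∷ ys) nz with at-split g ys nz
... | as , refl , eq = y ∷ as , refl , cong (y ∷_) eq

at-++-∷ : ∀ as x p → at (as ++ x ∷ p) (suc (length as)) ≡ x
at-++-∷ []       x p = refl
at-++-∷ (a ∷ as) x p = at-++-∷ as x p

drop-++-∷ : ∀ as (x : ℕ) p → drop (suc (length as)) (as ++ x ∷ p) ≡ p
drop-++-∷ []       x p = refl
drop-++-∷ (a ∷ as) x p = drop-++-∷ as x p

placed-∷⁻ : ∀ x π g gs p → x ≢ 0 → T (placed (x ∷ π) (g ∷ gs) p) →
            ∃[ as ] ∃[ p′ ] length as ≡ g × p ≡ as ++ x ∷ p′ × T (placed π gs p′)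
placed-∷⁻ x π g gs p x≢0 pl with Equivalence.to T-∧ (subst T (placed-∷ x π g gs p) pl)
... | hit , rest with ≡ᵇ⇒≡ (at p (suc g)) x hit
...   | refl with at-split g p x≢0
...     | as , len , eq = as , drop (suc g) p , len , eq , rest

placed-∷⁺ : ∀ x π gs as p′ → T (placed π gs p′) → T (placed (x ∷ π) (length as ∷ gs) (as ++ x ∷ p′))
placed-∷⁺ x π gs as p′ pl =
  subst T (sym (placed-∷ x π (length as) gs (as ++ x ∷ p′)))
    (Equivalence.from T-∧ (≡⇒≡ᵇ _ x (at-++-∷ as x p′) , subst (T ∘ placed π gs) (sym (drop-++-∷ as x p′)) pl))

placed-++⁻ : ∀ {n π gs p} xs → length xs ≡ n → 0 ∉ xs →
             T (placed (xs ++ π) (replicate n 0 ++ gs) p) → ∃[ p′ ] p ≡ xs ++ p′ × T (placed π gs p′)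
placed-++⁻ []       refl _   pl = _ , refl , pl
placed-++⁻ {π = π} {gs} {p} (x ∷ xs) refl 0∉ pl
  with placed-∷⁻ x (xs ++ π) 0 (replicate (length xs) 0 ++ gs) p (λ x≡0 → 0∉ (here (sym x≡0))) pl
... | [] , p₁ , refl , refl , pl₁ with placed-++⁻ {p = p₁} xs refl (0∉ ∘ there) pl₁
...   | p′ , refl , pl′ = p′ , refl , pl′

placed-++⁺ : ∀ {n π gs p′} xs → length xs ≡ n → T (placed π gs p′) →
             T (placed (xs ++ π) (replicate n 0 ++ gs) (xs ++ p′))
placed-++⁺ []       refl pl = pl
placed-++⁺ {π = π} {gs} {p′} (x ∷ xs) refl pl =
  placed-∷⁺ x (xs ++ π) (replicate (length xs) 0 ++ gs) [] (xs ++ p′) (placed-++⁺ xs refl pl)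

placed-zeros⁻ : ∀ {n p} xs → length xs ≡ n → 0 ∉ xs → T (placed xs (replicate (suc n) 0) p) → ∃[ q ] p ≡ xs ++ q
placed-zeros⁻ []       refl _   _  = _ , refl
placed-zeros⁻ {p = p} (x ∷ xs) refl 0∉ pl
  with placed-∷⁻ x xs 0 (replicate (suc (length xs)) 0) p (λ x≡0 → 0∉ (here (sym x≡0))) pl
... | [] , p₁ , refl , refl , pl₁ with placed-zeros⁻ {p = p₁} xs refl (0∉ ∘ there) pl₁
...   | q , refl = q , refl

placed-zeros⁺ : ∀ {n} xs → length xs ≡ n → T (placed xs (replicate (suc n) 0) xs)
placed-zeros⁺ []       refl = tt
placed-zeros⁺ (x ∷ xs) refl = placed-∷⁺ x xs (replicate (suc (length xs)) 0) [] xs (placed-zeros⁺ xs refl)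

placed-gap-desc⁺ : ∀ y m → T (placed (desc 0 m) (1 ∷ replicate m 0) (y ∷ desc 0 m))
placed-gap-desc⁺ y zero    = tt
placed-gap-desc⁺ y (suc m) =
  placed-∷⁺ (suc m) (desc 0 m) (replicate (suc m) 0) (y ∷ []) (desc 0 m) (placed-zeros⁺ (desc 0 m) (length-desc 0 m))

placed-gap-desc⁻ : ∀ m {p} → 0 < m → T (placed (desc 0 m) (1 ∷ replicate m 0) p) →
                   ∃[ y ] ∃[ q ] p ≡ y ∷ desc 0 m ++ q
placed-gap-desc⁻ (suc m) {p} _ pl with placed-∷⁻ (suc m) (desc 0 m) 1 (replicate (suc m) 0) p (λ ()) pl
... | y ∷ [] , p₁ , refl , refl , pl₁ with placed-zeros⁻ {p = p₁} (desc 0 m) (length-desc 0 m) (0∉desc 0 m) pl₁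
...   | q , refl = y , q , refl

sum-zeros-++ : ∀ n xs → sum (replicate n 0 ++ xs) ≡ sum xs
sum-zeros-++ zero    xs = refl
sum-zeros-++ (suc n) xs = sum-zeros-++ n xs

sum-zeros : ∀ n → sum (replicate n 0) ≡ 0
sum-zeros zero    = refl
sum-zeros (suc n) = sum-zeros n

-- Two new maxima in a decreasing permutation

-- base = t (t−1) … 1 has the entry suc m at position i + 1.  In both gap vectors the free
-- values of a permutation in Z are t + 1 and t + 2: aroundGaps has one slot on each side of
-- suc m, beforeGaps a double slot in front of it, and around/before fill these slots.
module TwoInsertions (m i : ℕ) where

  t : ℕ
  t = suc m + i

  D E base : List ℕ
  D    = desc (suc m) i
  E    = desc 0 m
  base = D ++ suc m ∷ E

  around before : ℕ → ℕ → List ℕ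
  around x y = D ++ x ∷ suc m ∷ y ∷ E
  before x y = D ++ x ∷ y ∷ suc m ∷ E

  aroundGaps beforeGaps : List ℕ
  aroundGaps = replicate i 0 ++ 1 ∷ 1 ∷ replicate m 0
  beforeGaps = replicate i 0 ++ 2 ∷ replicate (suc m) 0

  base≡desc : base ≡ desc 0 t
  base≡desc = trans (sym (desc-++ 0 i (suc m))) (cong (desc 0) (+-comm i (suc m)))

  length-base : length base ≡ t
  length-base = trans (cong length base≡desc) (length-desc 0 t)

  t<1+t : t < suc t
  t<1+t = ≤-refl

  t<2+t : t < suc (suc t)
  t<2+t = n≤1+n (suc t)

  2+t≢1+t : suc (suc t) ≢ suc t
  2+t≢1+t = 1+n≢n

  big∉D : ∀ {v} → t < v → v ∉ D
  big∉D t<v v∈ = <⇒≱ t<v (proj₂ (∈-desc⁻ (suc m) i v∈))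

  big∉sm∷E : ∀ {v} → t < v → v ∉ suc m ∷ E
  big∉sm∷E t<v (here refl) = <⇒≱ t<v (m≤m+n (suc m) i)
  big∉sm∷E t<v (there v∈)  = <⇒≱ t<v (≤-trans (proj₂ (∈-desc⁻ 0 m v∈)) (≤-trans (n≤1+n m) (m≤m+n (suc m) i)))

  ↭-desc : ∀ {x y} → x ∷ y ∷ [] ↭ suc (suc t) ∷ suc t ∷ [] → x ∷ y ∷ base ↭ desc 0 (suc (suc t))
  ↭-desc {x} {y} xy↭ =
    subst (x ∷ y ∷ base ↭_) (cong (λ l → suc (suc t) ∷ suc t ∷ l) base≡desc) (++⁺ʳ base xy↭)

  around-↭ : ∀ x y → around x y ↭ x ∷ y ∷ base
  around-↭ = ↭-pull₂ D (suc m ∷ []) E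

  before-↭ : ∀ x y → before x y ↭ x ∷ y ∷ base
  before-↭ = ↭-pull₂ D [] (suc m ∷ E)

  ∈-perms-tops : ∀ {n x y p} → n ≡ suc (suc t) → x ∷ y ∷ [] ↭ suc (suc t) ∷ suc t ∷ [] →
                 p ↭ x ∷ y ∷ base → p ∈ perms n
  ∈-perms-tops refl xy↭ p↭ = ∈-perms⁺ _ (↭-trans p↭ (↭-desc xy↭))

  ascentsAbove-base : AscentsAbove t base
  ascentsAbove-base = subst (AscentsAbove t) (sym base≡desc) (ascentsAbove-desc t 0 t)

  ascentsAbove-around : ∀ {x y} → t < x → t < y → AscentsAbove t (around x y)
  ascentsAbove-around t<x t<y = ascentsAbove-insert D t<x
    (subst (AscentsAbove t) (++-assoc D (suc m ∷ []) (_ ∷ E))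
      (ascentsAbove-insert (D ++ suc m ∷ []) t<y
        (subst (AscentsAbove t) (sym (++-assoc D (suc m ∷ []) E)) ascentsAbove-base)))

  ascentsAbove-before : ∀ {x y} → t < x → t < y → AscentsAbove t (before x y)
  ascentsAbove-before t<x t<y = ascentsAbove-insert D t<x (ascentsAbove-insert D t<y ascentsAbove-base)

  around-avoids : T (avoidsAll B₀ (around (suc t) (suc (suc t))))
  around-avoids = ascentsAbove⇒avoidsAll-B₀ (ascentsAbove-around t<1+t t<2+t)
    (bounded-of-↭ (↭-trans (around-↭ _ _) (↭-desc (swap _ _ ↭-refl)))) noSplit
    where
    noSplit : ∀ {b d} → ¬ (suc (suc t) ∷ b ∷ suc t ∷ d ∷ [] ⊆ around (suc t) (suc (suc t)))
    noSplit occ = big∉sm∷E t<1+t (there (to∈ (∷ˡ⁻ (∷⁻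
      (∷ʳ⁻ (λ eq → big∉sm∷E t<2+t (here eq)) (∷ʳ⁻ 2+t≢1+t (∷⊆-++⁻ D (big∉D t<2+t) occ)))))))

  around-swapped-avoids : (∀ {d} → d ∉ E) → T (avoidsAll B₀ (around (suc (suc t)) (suc t)))
  around-swapped-avoids E-empty = ascentsAbove⇒avoidsAll-B₀ (ascentsAbove-around t<2+t t<1+t)
    (bounded-of-↭ (↭-trans (around-↭ _ _) (↭-desc ↭-refl))) noSplit
    where
    noSplit : ∀ {b d} → ¬ (suc (suc t) ∷ b ∷ suc t ∷ d ∷ [] ⊆ around (suc (suc t)) (suc t))
    noSplit occ with ∷⁻ (∷⁻ (∷⊆-++⁻ D (big∉D t<2+t) occ))
    ... | _ ∷ʳ occ′ = big∉sm∷E t<1+t (there (to∈ occ′))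
    ... | refl ∷ d⊆ = E-empty (to∈ d⊆)

  around-swapped-contains : ∀ {d} → d ∈ E → ¬ T (avoidsAll B₀ (around (suc (suc t)) (suc t)))
  around-swapped-contains d∈ = occurrence4231⇒¬avoidsAll-B₀ (++⁺ˡ D (refl ∷ refl ∷ refl ∷ from∈ d∈))
    (s≤s (proj₂ (∈-desc⁻ 0 m d∈))) (s≤s (m≤m+n (suc m) i)) ≤-refl

  before-avoids : ∀ {x y} → x ∷ y ∷ [] ↭ suc (suc t) ∷ suc t ∷ [] → T (avoidsAll B₀ (before x y))
  before-avoids xy↭ with ↭-pair⁻ xy↭
  ... | _ , inj₁ (refl , refl) = ascentsAbove⇒avoidsAll-B₀ (ascentsAbove-before t<2+t t<1+t)
    (bounded-of-↭ (↭-trans (before-↭ _ _) (↭-desc xy↭)))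
    (λ occ → big∉sm∷E t<1+t (to∈ (∷⁻ (∷⁻ (∷⊆-++⁻ D (big∉D t<2+t) occ)))))
  ... | _ , inj₂ (refl , refl) = ascentsAbove⇒avoidsAll-B₀ (ascentsAbove-before t<1+t t<2+t)
    (bounded-of-↭ (↭-trans (before-↭ _ _) (↭-desc xy↭)))
    (λ occ → big∉sm∷E t<1+t (to∈ (∷ˡ⁻ (∷⁻ (∷ʳ⁻ 2+t≢1+t (∷⊆-++⁻ D (big∉D t<2+t) occ))))))

  placed-around⁺ : ∀ x y → T (placed base aroundGaps (around x y))
  placed-around⁺ x y = placed-++⁺ D (length-desc (suc m) i)
    (placed-∷⁺ (suc m) E (1 ∷ replicate m 0) (x ∷ []) (y ∷ E) (placed-gap-desc⁺ y m))

  placed-before⁺ : ∀ x y → T (placed base beforeGaps (before x y))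
  placed-before⁺ x y = placed-++⁺ D (length-desc (suc m) i)
    (placed-∷⁺ (suc m) E (replicate (suc m) 0) (x ∷ y ∷ []) E (placed-zeros⁺ E (length-desc 0 m)))

  size-around : length base + sum aroundGaps ≡ suc (suc t)
  size-around = trans (cong₂ _+_ length-base (trans (sum-zeros-++ i _) (cong (2 +_) (sum-zeros m)))) (+-comm t 2)

  size-before : length base + sum beforeGaps ≡ suc (suc t)
  size-before =
    trans (cong₂ _+_ length-base (trans (sum-zeros-++ i _) (cong (2 +_) (sum-zeros (suc m))))) (+-comm t 2)

  around-↭⁻ : ∀ {x y q} → D ++ x ∷ suc m ∷ y ∷ E ++ q ↭ desc 0 (suc (suc t)) →
              x ∷ y ∷ q ↭ suc (suc t) ∷ suc t ∷ []
  around-↭⁻ {x} {y} {q} p↭ = ↭-cancelˡ base (↭-trans (↭-sym pulled) (↭-trans p↭ tops))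
    where
    pulled : D ++ x ∷ suc m ∷ y ∷ E ++ q ↭ base ++ x ∷ y ∷ q
    pulled = ↭-trans (↭-pull₂ D (suc m ∷ []) (E ++ q) x y)
      (subst (λ l → x ∷ y ∷ l ↭ base ++ x ∷ y ∷ q) (++-assoc D (suc m ∷ E) q) (shifts (x ∷ y ∷ []) base))
    tops : desc 0 (suc (suc t)) ↭ base ++ suc (suc t) ∷ suc t ∷ []
    tops = subst (_↭ base ++ suc (suc t) ∷ suc t ∷ [])
      (cong (λ l → suc (suc t) ∷ suc t ∷ l) (trans (++-identityʳ base) base≡desc))
      (shifts (suc (suc t) ∷ suc t ∷ []) base {[]})

  around-unique : 0 < m → ∀ {p} → p ↭ desc 0 (suc (suc t)) → T (placed base aroundGaps p) →
                  p ≡ around (suc t) (suc (suc t)) ⊎ p ≡ around (suc (suc t)) (suc t)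
  around-unique 0<m {p} p↭ pl
    with placed-++⁻ {π = suc m ∷ E} {1 ∷ 1 ∷ replicate m 0} {p} D (length-desc (suc m) i) (0∉desc (suc m) i) pl
  ... | p₁ , refl , pl₁
    with placed-∷⁻ (suc m) E 1 (1 ∷ replicate m 0) p₁ (λ ()) pl₁
  ... | x ∷ [] , p₂ , refl , refl , pl₂
    with placed-gap-desc⁻ m {p₂} 0<m pl₂
  ... | y , q , refl
    with ↭-pair⁻ (around-↭⁻ p↭)
  ... | refl , inj₁ (refl , refl) = inj₂ (cong (λ l → D ++ suc (suc t) ∷ suc m ∷ suc t ∷ l) (++-identityʳ E))
  ... | refl , inj₂ (refl , refl) = inj₁ (cong (λ l → D ++ suc t ∷ suc m ∷ suc (suc t) ∷ l) (++-identityʳ E))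

  Zcount-around≡1 : 0 < m → Zcount B₀ base aroundGaps ≡ 1
  Zcount-around≡1 0<m = ≤-antisym (count-unique P (perms-unique n) only)
    (count-∈ P (∈-perms-tops size-around (swap _ _ ↭-refl) (around-↭ _ _))
               (Equivalence.from T-∧ (around-avoids , placed-around⁺ _ _)))
    where
    P : List ℕ → Bool
    P p = avoidsAll B₀ p ∧ placed base aroundGaps p
    n = length base + sum aroundGaps
    only : ∀ {p} → p ∈ perms n → T (P p) → p ≡ around (suc t) (suc (suc t))
    only {p} p∈ Pp with Equivalence.to T-∧ Pp
    ... | avoids , pl with around-unique 0<m (subst (λ n → p ↭ desc 0 n) size-around (∈-perms⁻ n p∈)) pl
    ...   | inj₁ eq   = eq
    ...   | inj₂ refl = ⊥-elim (around-swapped-contains (top∈desc 0 m 0<m) avoids)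

  private
    shapes-count≥2 : ∀ {gs} (shape : ℕ → ℕ → List ℕ) → length base + sum gs ≡ suc (suc t) →
      (∀ x y → shape x y ↭ x ∷ y ∷ base) → (∀ x y → T (placed base gs (shape x y))) →
      (∀ {x y x′ y′} → shape x y ≡ shape x′ y′ → x ≡ x′) →
      T (avoidsAll B₀ (shape (suc t) (suc (suc t)))) → T (avoidsAll B₀ (shape (suc (suc t)) (suc t))) →
      2 ≤ Zcount B₀ base gs
    shapes-count≥2 {gs} shape size shape-↭ placed-shape injective avoids avoids′ =
      count-∈₂ (λ p → avoidsAll B₀ p ∧ placed base gs p)
        (∈-perms-tops size (swap _ _ ↭-refl) (shape-↭ _ _)) (∈-perms-tops size ↭-refl (shape-↭ _ _))
        (λ eq → 2+t≢1+t (sym (injective eq)))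
        (Equivalence.from T-∧ (avoids , placed-shape _ _)) (Equivalence.from T-∧ (avoids′ , placed-shape _ _))

  Zcount-around≥2 : (∀ {d} → d ∉ E) → 2 ≤ Zcount B₀ base aroundGaps
  Zcount-around≥2 E-empty = shapes-count≥2 {aroundGaps} around size-around around-↭ placed-around⁺
    (∷-injectiveˡ ∘ ++-cancelˡ D _ _) around-avoids (around-swapped-avoids E-empty)

  Zcount-before≥2 : 2 ≤ Zcount B₀ base beforeGaps
  Zcount-before≥2 = shapes-count≥2 {beforeGaps} before size-before before-↭ placed-before⁺
    (∷-injectiveˡ ∘ ++-cancelˡ D _ _) (before-avoids (swap _ _ ↭-refl)) (before-avoids ↭-refl)

deleteAt-++-∷ : ∀ xs (y : ℕ) ys → deleteAt (suc (length xs)) (xs ++ y ∷ ys) ≡ xs ++ ys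
deleteAt-++-∷ []       y ys = refl
deleteAt-++-∷ (x ∷ xs) y ys = cong (x ∷_) (deleteAt-++-∷ xs y ys)

dg-++ : ∀ xs a b rest → dg (suc (length xs)) (xs ++ a ∷ b ∷ rest) ≡ xs ++ (a + b) ∷ rest
dg-++ []       a b rest = refl
dg-++ (x ∷ xs) a b rest = cong (x ∷_) (dg-++ xs a b rest)

toList-replicate : ∀ n (x : ℕ) → toList (Vec.replicate n x) ≡ replicate n x
toList-replicate zero    x = refl
toList-replicate (suc n) x = cong (x ∷_) (toList-replicate n x)

aroundGapVec : (i m : ℕ) → Vec ℕ (suc (suc i + m))
aroundGapVec zero    m = 1 Vec.∷ 1 Vec.∷ Vec.replicate m 0
aroundGapVec (suc i) m = 0 Vec.∷ aroundGapVec i m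

toList-aroundGapVec : ∀ i m → toList (aroundGapVec i m) ≡ TwoInsertions.aroundGaps m i
toList-aroundGapVec zero    m = cong (λ l → 1 ∷ 1 ∷ l) (toList-replicate m 0)
toList-aroundGapVec (suc i) m = cong (0 ∷_) (toList-aroundGapVec i m)

decreasing≡base : ∀ i m → decreasing (suc i + m) ≡ TwoInsertions.base m i
decreasing≡base i m = trans (decreasing≡desc (suc i + m))
  (trans (cong (desc 0) (trans (+-comm (suc i) m) (+-suc m i))) (sym (TwoInsertions.base≡desc m i)))

¬ESReducible-of-counts : ∀ B {k} π r (g : Vec ℕ (suc k)) → Zcount B π (toList g) ≡ 1 →
                         2 ≤ Zcount B (dπ r π) (dg r (toList g)) → ¬ ESReducible B k π r
¬ESReducible-of-counts B π r g one two reducible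
  with subst (2 ≤_) (trans (sym (reducible g (λ none → 1+n≢0 (trans (sym one) none)))) one) two
... | s≤s ()

module _ (i : ℕ) where
  open TwoInsertions

  dπ-inner : ∀ j → dπ (suc i) (base (suc j) i) ≡ base j i
  dπ-inner j = trans (cong st deleted) (st-desc-++-desc (suc j) i (n≤1+n (suc j)))
    where
    deleted : deleteAt (suc i) (base (suc j) i) ≡ D (suc j) i ++ E (suc j) i
    deleted = subst (λ n → deleteAt (suc n) (base (suc j) i) ≡ D (suc j) i ++ E (suc j) i)
                    (length-desc (suc (suc j)) i) (deleteAt-++-∷ (D (suc j) i) (suc (suc j)) (E (suc j) i))

  dg-inner : ∀ j → dg (suc i) (aroundGaps (suc j) i) ≡ beforeGaps j i
  dg-inner j = subst (λ n → dg (suc n) (aroundGaps (suc j) i) ≡ beforeGaps j i)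
                     (length-replicate i) (dg-++ (replicate i 0) 1 1 (replicate (suc j) 0))

  dπ-last : dπ (suc i + 1) (base 1 i) ≡ base 0 i
  dπ-last = trans (cong st deleted) (st-desc-++-desc {1} {2} 1 i ≤-refl)
    where
    open ≡-Reasoning
    front = desc 2 i ++ 2 ∷ []
    length-front : length front ≡ i + 1
    length-front = trans (length-++ (desc 2 i)) (cong (_+ 1) (length-desc 2 i))
    deleted : deleteAt (suc i + 1) (base 1 i) ≡ front
    deleted = begin
      deleteAt (suc i + 1) (base 1 i)                 ≡⟨ cong (deleteAt (suc i + 1))
                                                           (sym (++-assoc (desc 2 i) (2 ∷ []) (1 ∷ []))) ⟩
      deleteAt (suc (i + 1)) (front ++ 1 ∷ [])        ≡⟨ cong (λ n → deleteAt (suc n) (front ++ 1 ∷ []))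
                                                           (sym length-front) ⟩
      deleteAt (suc (length front)) (front ++ 1 ∷ []) ≡⟨ deleteAt-++-∷ front 1 [] ⟩
      front ++ []                                     ≡⟨ ++-identityʳ front ⟩
      front                                           ∎

  dg-last : dg (suc i + 1) (aroundGaps 1 i) ≡ aroundGaps 0 i
  dg-last = begin
    dg (suc i + 1) (aroundGaps 1 i)               ≡⟨ cong (dg (suc i + 1))
                                                       (sym (++-assoc (replicate i 0) (1 ∷ []) (1 ∷ 0 ∷ []))) ⟩
    dg (suc (i + 1)) (front ++ 1 ∷ 0 ∷ [])        ≡⟨ cong (λ n → dg (suc n) (front ++ 1 ∷ 0 ∷ [])) (sym length-front) ⟩
    dg (suc (length front)) (front ++ 1 ∷ 0 ∷ []) ≡⟨ dg-++ front 1 0 [] ⟩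
    front ++ 1 ∷ []                               ≡⟨ ++-assoc (replicate i 0) (1 ∷ []) (1 ∷ []) ⟩
    aroundGaps 0 i                                ∎
    where
    open ≡-Reasoning
    front = replicate i 0 ++ 1 ∷ []
    length-front : length front ≡ i + 1
    length-front = trans (length-++ (replicate i 0)) (cong (_+ 1) (length-replicate i))

  Zcount-decreasing≡1 : ∀ m → 0 < m → Zcount B₀ (decreasing (suc i + m)) (toList (aroundGapVec i m)) ≡ 1
  Zcount-decreasing≡1 m 0<m =
    subst₂ (λ π g → Zcount B₀ π g ≡ 1) (sym (decreasing≡base i m)) (sym (toList-aroundGapVec i m))
      (Zcount-around≡1 m i 0<m)

  inner-entry-irreducible : ∀ j → ¬ ESReducible B₀ (suc i + suc j) (decreasing (suc i + suc j)) (suc i)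
  inner-entry-irreducible j = ¬ESReducible-of-counts B₀ (decreasing (suc i + suc j)) (suc i)
    (aroundGapVec i (suc j)) (Zcount-decreasing≡1 (suc j) (s≤s z≤n))
    (subst₂ (λ π g → 2 ≤ Zcount B₀ (dπ (suc i) π) (dg (suc i) g))
      (sym (decreasing≡base i (suc j))) (sym (toList-aroundGapVec i (suc j)))
      (subst₂ (λ π g → 2 ≤ Zcount B₀ π g) (sym (dπ-inner j)) (sym (dg-inner j)) (Zcount-before≥2 j i)))

  last-entry-irreducible : ¬ ESReducible B₀ (suc i + 1) (decreasing (suc i + 1)) (suc i + 1)
  last-entry-irreducible = ¬ESReducible-of-counts B₀ (decreasing (suc i + 1)) (suc i + 1)
    (aroundGapVec i 1) (Zcount-decreasing≡1 1 (s≤s z≤n))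
    (subst₂ (λ π g → 2 ≤ Zcount B₀ (dπ (suc i + 1) π) (dg (suc i + 1) g))
      (sym (decreasing≡base i 1)) (sym (toList-aroundGapVec i 1))
      (subst₂ (λ π g → 2 ≤ Zcount B₀ π g) (sym dπ-last) (sym dg-last) (Zcount-around≥2 0 i (λ ()))))

-- For k = 1 the gaps (0,3) already separate the counts: |Z(B;1;(0,3))| = 5 and |Z(B;∅;(3))| = 6.
singleton-irreducible : ¬ ESReducible B₀ 1 (decreasing 1) 1
singleton-irreducible reducible with reducible (0 Vec.∷ 3 Vec.∷ Vec.[]) (λ ())
... | ()

<⇒≡+suc : ∀ {r k} → r < k → ∃[ j ] k ≡ r + suc j
<⇒≡+suc {r} r<k with m≤n⇒∃[o]m+o≡n r<k
... | j , eq = j , trans (sym eq) (sym (+-suc r j))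

mainTheorem4 : (k : ℕ) → 1 ≤ k → (r : ℕ) → 1 ≤ r → r ≤ k →
    ¬ ESReducible B₀ k (decreasing k) r
mainTheorem4 k _ (suc i) _ r≤k with m≤n⇒m<n∨m≡n r≤k
... | inj₁ r<k with <⇒≡+suc r<k
...   | j , refl = inner-entry-irreducible i j
mainTheorem4 _ _ (suc zero)    _ _ | inj₂ refl = singleton-irreducible
mainTheorem4 _ _ (suc (suc i)) _ _ | inj₂ refl =
  subst (λ n → ¬ ESReducible B₀ n (decreasing n) n) (+-comm (suc i) 1) (last-entry-irreducible i)
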